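{- For every nonnegative integer $m$ and $t$ in a neighborhood of zero where both sides converge, \[ \sum_{n=0}^{\infty}S(n+1,m+1)\,H_n(x)\frac{t^n}{n!}=e^{2xt-t^2}\sum_{n=0}^{\infty}S(n,m)\,H_n(x-t)\frac{t^n}{n!}. \]
   Context: $H_n(x)$ denote the Hermite polynomials, defined by $e^{2xt-t^2}=\sum_{n=0}^\infty H_n(x)\frac{t^n}{n!}$; $S(n,m)$ denotes the Stirling numbers of the second kind (with $S(0,0)=1$). -}

module Defs where

open import Data.Nat as ℕ using (ℕ; zero; suc; _!; _∸_)
open import Data.Nat.Properties using (_!≢0)
open import Data.Integer as ℤ using (ℤ; +_)
open import Data.Rational using (ℚ; 0ℚ; 1ℚ; _+_; _*_; -_; _/_)

S : ℕ → ℕ → ℕ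
S zero    zero    = 1
S zero    (suc k) = 0
S (suc n) zero    = 0
S (suc n) (suc k) = suc k ℕ.* S n (suc k) ℕ.+ S n k

sumTo : ℕ → (ℕ → ℚ) → ℚ
sumTo zero    f = f 0
sumTo (suc n) f = sumTo n f + f (suc n)

fromℕ : ℕ → ℚ
fromℕ n = (+ n) / 1

invFact : ℕ → ℚ
invFact n = let instance _ = n !≢0 in (+ 1) / (n !)

-- Univariate formal power series in x over ℚ: coefficient of x^i.
Ser1 : Set
Ser1 = ℕ → ℚ

-- Bivariate formal power series in x, t over ℚ: f i j = coefficient of x^i t^j.
Ser2 : Set
Ser2 = ℕ → ℕ → ℚ

_⊕_ : Ser2 → Ser2 → Ser2
(f ⊕ g) i j = f i j + g i j

_⊖_ : Ser2 → Ser2 → Ser2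
(f ⊖ g) i j = f i j + - g i j

scal : ℚ → Ser2 → Ser2
scal c f i j = c * f i j

_⊛_ : Ser2 → Ser2 → Ser2
(f ⊛ g) i j = sumTo i λ a → sumTo j λ b → f a b * g (i ∸ a) (j ∸ b)

one : Ser2
one zero zero = 1ℚ
one _    _    = 0ℚ

pow : Ser2 → ℕ → Ser2
pow f zero    = one
pow f (suc k) = f ⊛ pow f k

X : Ser2
X 1 0 = 1ℚ
X _ _ = 0ℚ

T : Ser2
T 0 1 = 1ℚ
T _ _ = 0ℚ

-- Substitution h(g) = Σ_k h_k g^k of a bivariate series g with zero constant
-- term into a univariate series h; the coefficient of x^i t^j only receives
-- contributions from k ≤ i + j, so the sum is finite.
subst : Ser1 → Ser2 → Ser2
subst h g i j = sumTo (i ℕ.+ j) λ k → h k * pow g k i j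

-- exp(g) for g with zero constant term
expS : Ser2 → Ser2
expS g = subst invFact g

genH : Ser2
genH = expS (scal (fromℕ 2) (X ⊛ T) ⊖ pow T 2)

-- Hermite polynomial H_n(x), defined by e^{2xt-t^2} = Σ H_n(x) t^n/n!:
-- coefficient of x^i in H_n is n! · [x^i t^n] e^{2xt-t^2}.
H : ℕ → Ser1
H n i = fromℕ (n !) * genH i n

inX : Ser1 → Ser2
inX h i zero    = h i
inX h i (suc j) = 0ℚ

-- Σ_{n≥0} F n for a family with F n divisible by t^n (t-adically convergent):
-- the coefficient of x^i t^j only gets contributions from n ≤ j.
sumT : (ℕ → Ser2) → Ser2
sumT F i j = sumTo j λ n → F n i j

lhs : ℕ → Ser2
lhs m = sumT λ n → scal (fromℕ (S (suc n) (suc m)) * invFact n) (pow T n ⊛ inX (H n))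

rhs : ℕ → Ser2
rhs m = genH ⊛ sumT λ n → scal (fromℕ (S n m) * invFact n) (pow T n ⊛ subst (H n) (X ⊖ T))

-- Compare coefficients of x^i t^j, writing g_ij for those of e^{2xt−t²}. Since H_n(x)/n! is the
-- t^n coefficient of e^{2xt−t²}, the left side gives S(j+1,m+1) g_ij. From
-- ∂_t e^{2xt−t²} = 2(x−t) e^{2xt−t²} one gets H_{n+1} = 2x H_n − 2n H_{n−1}, and then both
-- e^{2xt−t²} H_n(x−t) and ∂_t^n e^{2xt−t²} satisfy u_{n+1} = 2(x−t) u_n − 2n u_{n−1} with
-- u_0 = e^{2xt−t²}, so they agree: the t^d coefficient of e^{2xt−t²} H_n(x−t) is
-- (d+n)!/d! · g_{i,d+n}. The right side therefore gives Σ_n C(j,n) S(n,m) g_ij, and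
-- Σ_n C(j,n) S(n,m) = S(j+1,m+1) (the n elements outside the block of a fixed element).

{-# OPTIONS --safe #-}
module Submission where

open import Defs
open import Data.Nat as ℕ using (ℕ; zero; suc; _!; _∸_; _≤_; _<_; z≤n; s≤s)
import Data.Nat.Properties as ℕP
open import Data.Nat.Combinatorics using (_C_; k![n∸k]!∣n!; nCk+nC[k+1]≡[n+1]C[k+1])
open import Data.Nat.Combinatorics.Specification using (nCk≡n!/k![n-k]!; k>n⇒nCk≡0)
open import Data.Nat.DivMod using (m/n*n≡m)
import Data.Integer as ℤ
import Data.Integer.Properties as ℤP
open import Data.Integer.Solver using () renaming (module +-*-Solver to ℤ-Solver)
open import Data.Rational using (ℚ; 0ℚ; 1ℚ; _+_; _*_; -_; _/_; toℚᵘ)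
open import Data.Rational.Properties
import Data.Rational.Unnormalised as ℚᵘ
import Data.Rational.Unnormalised.Properties as ℚᵘ
open import Data.Rational.Solver using (module +-*-Solver)
open import Data.Product using (_×_; _,_; proj₂)
open import Relation.Binary.PropositionalEquality hiding (subst)

toℚᵘ-fromℕ : ∀ n → toℚᵘ (fromℕ n) ℚᵘ.≃ ℚᵘ.mkℚᵘ (ℤ.+ n) 0
toℚᵘ-fromℕ n = toℚᵘ-fromℚᵘ (ℚᵘ.mkℚᵘ (ℤ.+ n) 0)

fromℕ-+ : ∀ a b → fromℕ (a ℕ.+ b) ≡ fromℕ a + fromℕ b
fromℕ-+ a b = toℚᵘ-injective (ℚᵘ.≃-trans (toℚᵘ-fromℕ (a ℕ.+ b))
  (ℚᵘ.≃-trans (ℚᵘ.*≡* (solve 2 (λ x y → (x :+ y) :* con (ℤ.+ 1) := (x :* con (ℤ.+ 1) :+ y :* con (ℤ.+ 1)) :* con (ℤ.+ 1))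
                                refl (ℤ.+ a) (ℤ.+ b)))
    (ℚᵘ.≃-sym (ℚᵘ.≃-trans (toℚᵘ-homo-+ (fromℕ a) (fromℕ b)) (ℚᵘ.+-cong (toℚᵘ-fromℕ a) (toℚᵘ-fromℕ b))))))
  where open ℤ-Solver

fromℕ-* : ∀ a b → fromℕ (a ℕ.* b) ≡ fromℕ a * fromℕ b
fromℕ-* a b = toℚᵘ-injective (ℚᵘ.≃-trans (toℚᵘ-fromℕ (a ℕ.* b))
  (ℚᵘ.≃-trans (ℚᵘ.*≡* (cong (ℤ._* ℤ.+ 1) (ℤP.pos-* a b)))
    (ℚᵘ.≃-sym (ℚᵘ.≃-trans (toℚᵘ-homo-* (fromℕ a) (fromℕ b)) (ℚᵘ.*-cong (toℚᵘ-fromℕ a) (toℚᵘ-fromℕ b))))))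

fromℕ-suc : ∀ n → fromℕ (suc n) ≡ 1ℚ + fromℕ n
fromℕ-suc = fromℕ-+ 1

fromℕ-! : ∀ n → fromℕ (suc n !) ≡ fromℕ (suc n) * fromℕ (n !)
fromℕ-! n = fromℕ-* (suc n) (n !)

1/d*d≡1 : ∀ d .{{_ : ℕ.NonZero d}} → ((ℤ.+ 1) / d) * fromℕ d ≡ 1ℚ
1/d*d≡1 (suc k) = toℚᵘ-injective (ℚᵘ.≃-trans (toℚᵘ-homo-* ((ℤ.+ 1) / suc k) (fromℕ (suc k)))
  (ℚᵘ.≃-trans (ℚᵘ.*-cong (toℚᵘ-fromℚᵘ (ℚᵘ.mkℚᵘ (ℤ.+ 1) k)) (toℚᵘ-fromℕ (suc k)))
    (ℚᵘ.*≡* (trans (solve 1 (λ x → (con (ℤ.+ 1) :* x) :* con (ℤ.+ 1) := con (ℤ.+ 1) :* (x :* con (ℤ.+ 1))) refl (ℤ.+ suc k))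
                   (cong (ℤ.+ 1 ℤ.*_) (sym (ℤP.pos-* (suc k) 1)))))))
  where open ℤ-Solver

open +-*-Solver
open import Algebra.Bundles using (CommutativeMonoid)
open import Algebra.Properties.CommutativeSemigroup (CommutativeMonoid.commutativeSemigroup *-1-commutativeMonoid)
  using () renaming (x∙yz≈y∙xz to x*yz≡y*xz)
open import Algebra.Properties.CommutativeSemigroup ℕP.+-commutativeSemigroup using () renaming (interchange to +-interchange)

*-distribˡ-− : ∀ w a b → w * (a + - b) ≡ w * a + - (w * b)
*-distribˡ-− = solve 3 (λ w a b → w :* (a :+ :- b) := w :* a :+ :- (w :* b)) refl

*-distribʳ-− : ∀ w a b → (a + - b) * w ≡ a * w + - (b * w)
*-distribʳ-− = solve 3 (λ w a b → (a :+ :- b) :* w := a :* w :+ :- (b :* w)) refl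

*-scaled-difference : ∀ c w a b → c * (w * a + - (w * b)) ≡ w * (c * a) + - (w * (c * b))
*-scaled-difference = solve 4 (λ c w a b → c :* (w :* a :+ :- (w :* b)) := w :* (c :* a) :+ :- (w :* (c :* b))) refl

invFact-*-! : ∀ n → invFact n * fromℕ (n !) ≡ 1ℚ
invFact-*-! n = let instance _ = ℕP._!≢0 n in 1/d*d≡1 (n !)

inverse-unique : ∀ a b c → a * c ≡ 1ℚ → b * c ≡ 1ℚ → a ≡ b
inverse-unique a b c ac≡1 bc≡1 = begin
  a            ≡⟨ sym (*-identityʳ a) ⟩
  a * 1ℚ       ≡⟨ cong (a *_) (sym bc≡1) ⟩
  a * (b * c)  ≡⟨ solve 3 (λ a b c → a :* (b :* c) := (a :* c) :* b) refl a b c ⟩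
  (a * c) * b  ≡⟨ cong (_* b) ac≡1 ⟩
  1ℚ * b       ≡⟨ *-identityˡ b ⟩
  b            ∎
  where open ≡-Reasoning

invFact-suc : ∀ n → invFact (suc n) * fromℕ (suc n) ≡ invFact n
invFact-suc n = inverse-unique _ _ (fromℕ (n !))
  (trans (*-assoc (invFact (suc n)) (fromℕ (suc n)) (fromℕ (n !)))
         (trans (cong (invFact (suc n) *_) (sym (fromℕ-! n))) (invFact-*-! (suc n))))
  (invFact-*-! n)

fromℕ-C : ∀ {n k} → k ≤ n → fromℕ (n C k) ≡ fromℕ (n !) * (invFact k * invFact (n ∸ k))
fromℕ-C {n} {k} k≤n = begin
  c                        ≡⟨ sym (trans (*-identityʳ (c * 1ℚ)) (*-identityʳ c)) ⟩
  c * 1ℚ * 1ℚ              ≡⟨ cong₂ (λ x y → c * x * y) (sym (invFact-*-! k)) (sym (invFact-*-! (n ∸ k))) ⟩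
  c * (ik * a) * (ib * b)  ≡⟨ solve 5 (λ c a b x y → c :* (x :* a) :* (y :* b) := c :* (a :* b) :* (x :* y)) refl c a b ik ib ⟩
  c * (a * b) * (ik * ib)  ≡⟨ cong (_* (ik * ib)) C*k!*[n∸k]! ⟩
  fromℕ (n !) * (ik * ib)  ∎
  where
  open ≡-Reasoning
  c = fromℕ (n C k)
  a = fromℕ (k !)
  b = fromℕ ((n ∸ k) !)
  ik = invFact k
  ib = invFact (n ∸ k)
  instance
    k![n∸k]!≢0 : ℕ.NonZero (k ! ℕ.* (n ∸ k) !)
    k![n∸k]!≢0 = ℕP.m*n≢0 (k !) ((n ∸ k) !) {{ℕP._!≢0 k}} {{ℕP._!≢0 (n ∸ k)}}
  C*k!*[n∸k]! : c * (a * b) ≡ fromℕ (n !)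
  C*k!*[n∸k]! = begin
    c * (a * b)                              ≡⟨ cong (c *_) (sym (fromℕ-* (k !) ((n ∸ k) !))) ⟩
    c * fromℕ (k ! ℕ.* (n ∸ k) !)            ≡⟨ sym (fromℕ-* (n C k) _) ⟩
    fromℕ ((n C k) ℕ.* (k ! ℕ.* (n ∸ k) !))
      ≡⟨ cong (λ x → fromℕ (x ℕ.* (k ! ℕ.* (n ∸ k) !))) (nCk≡n!/k![n-k]! k≤n) ⟩
    fromℕ (n ! ℕ./ (k ! ℕ.* (n ∸ k) !) ℕ.* _) ≡⟨ cong fromℕ (m/n*n≡m (k![n∸k]!∣n! k≤n)) ⟩
    fromℕ (n !)                              ∎

-- Finite sums

sumTo-cong-≤ : ∀ n {f g : ℕ → ℚ} → (∀ k → k ≤ n → f k ≡ g k) → sumTo n f ≡ sumTo n g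
sumTo-cong-≤ zero    f≡g = f≡g 0 z≤n
sumTo-cong-≤ (suc n) f≡g = cong₂ _+_ (sumTo-cong-≤ n (λ k k≤n → f≡g k (ℕP.m≤n⇒m≤1+n k≤n))) (f≡g (suc n) ℕP.≤-refl)

sumTo-cong : ∀ n {f g : ℕ → ℚ} → (∀ k → f k ≡ g k) → sumTo n f ≡ sumTo n g
sumTo-cong n f≡g = sumTo-cong-≤ n (λ k _ → f≡g k)

sumTo-zero : ∀ n {f : ℕ → ℚ} → (∀ k → k ≤ n → f k ≡ 0ℚ) → sumTo n f ≡ 0ℚ
sumTo-zero zero    f≡0 = f≡0 0 z≤n
sumTo-zero (suc n) f≡0 = cong₂ _+_ (sumTo-zero n (λ k k≤n → f≡0 k (ℕP.m≤n⇒m≤1+n k≤n))) (f≡0 (suc n) ℕP.≤-refl)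

sumTo-+ : ∀ n (f g : ℕ → ℚ) → sumTo n (λ k → f k + g k) ≡ sumTo n f + sumTo n g
sumTo-+ zero    f g = refl
sumTo-+ (suc n) f g = trans (cong (_+ (f (suc n) + g (suc n))) (sumTo-+ n f g))
  (solve 4 (λ a b c d → (a :+ b) :+ (c :+ d) := (a :+ c) :+ (b :+ d)) refl (sumTo n f) (sumTo n g) (f (suc n)) (g (suc n)))

sumTo-*ˡ : ∀ n c (f : ℕ → ℚ) → sumTo n (λ k → c * f k) ≡ c * sumTo n f
sumTo-*ˡ zero    c f = refl
sumTo-*ˡ (suc n) c f = trans (cong (_+ (c * f (suc n))) (sumTo-*ˡ n c f)) (sym (*-distribˡ-+ c (sumTo n f) (f (suc n))))

sumTo-*ʳ : ∀ n c (f : ℕ → ℚ) → sumTo n (λ k → f k * c) ≡ sumTo n f * c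
sumTo-*ʳ n c f = trans (sumTo-cong n (λ k → *-comm (f k) c)) (trans (sumTo-*ˡ n c f) (*-comm c (sumTo n f)))

sumTo-neg : ∀ n (f : ℕ → ℚ) → sumTo n (λ k → - f k) ≡ - sumTo n f
sumTo-neg zero    f = refl
sumTo-neg (suc n) f = trans (cong (_+ (- f (suc n))) (sumTo-neg n f)) (sym (neg-distrib-+ (sumTo n f) (f (suc n))))

sumTo-head : ∀ n (f : ℕ → ℚ) → sumTo (suc n) f ≡ f 0 + sumTo n (λ k → f (suc k))
sumTo-head zero    f = refl
sumTo-head (suc n) f = trans (cong (_+ f (suc (suc n))) (sumTo-head n f)) (+-assoc (f 0) _ _)

sumTo-first : ∀ n (f : ℕ → ℚ) → (∀ k → f (suc k) ≡ 0ℚ) → sumTo n f ≡ f 0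
sumTo-first zero    f f≡0 = refl
sumTo-first (suc n) f f≡0 = trans (cong₂ _+_ (sumTo-first n f f≡0) (f≡0 n)) (+-identityʳ (f 0))

sumTo-last : ∀ n (f : ℕ → ℚ) → (∀ k → k < n → f k ≡ 0ℚ) → sumTo n f ≡ f n
sumTo-last zero    f f≡0 = refl
sumTo-last (suc n) f f≡0 = trans (cong (_+ f (suc n)) (sumTo-zero n (λ k k≤n → f≡0 k (s≤s k≤n)))) (+-identityˡ (f (suc n)))

sumTo-extend : ∀ n N (f : ℕ → ℚ) → n ≤ N → (∀ k → n < k → f k ≡ 0ℚ) → sumTo N f ≡ sumTo n f
sumTo-extend n N f n≤N f≡0 = trans (cong (λ M → sumTo M f) (sym (ℕP.m∸n+n≡m n≤N))) (extend (N ∸ n))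
  where
  extend : ∀ d → sumTo (d ℕ.+ n) f ≡ sumTo n f
  extend zero    = refl
  extend (suc d) = trans (cong₂ _+_ (extend d) (f≡0 (suc (d ℕ.+ n)) (s≤s (ℕP.m≤n+m n d)))) (+-identityʳ (sumTo n f))

sumTo-swap : ∀ n m (g : ℕ → ℕ → ℚ) → sumTo n (λ a → sumTo m (λ b → g a b)) ≡ sumTo m (λ b → sumTo n (λ a → g a b))
sumTo-swap zero    m g = refl
sumTo-swap (suc n) m g = trans (cong (_+ sumTo m (g (suc n))) (sumTo-swap n m g))
  (sym (sumTo-+ m (λ b → sumTo n (λ a → g a b)) (g (suc n))))

sumTo-antidiagonal-suc : ∀ n (F : ℕ → ℕ → ℚ) → (∀ b → F b 0 ≡ 0ℚ) →
  sumTo (suc n) (λ b → F b (suc n ∸ b)) ≡ sumTo n (λ b → F b (suc (n ∸ b)))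
sumTo-antidiagonal-suc n F F≡0 = trans
  (cong₂ _+_ (sumTo-cong-≤ n (λ b b≤n → cong (F b) (ℕP.+-∸-assoc 1 b≤n)))
             (trans (cong (F (suc n)) (ℕP.n∸n≡0 n)) (F≡0 (suc n))))
  (+-identityʳ _)

sumTo-antidiagonal-corner : ∀ n (F : ℕ → ℕ → ℚ) → (∀ b k → F b (suc k) ≡ 0ℚ) → sumTo n (λ b → F b (n ∸ b)) ≡ F n 0
sumTo-antidiagonal-corner zero    F F≡0 = refl
sumTo-antidiagonal-corner (suc n) F F≡0 = trans
  (cong₂ _+_ (sumTo-zero n (λ b b≤n → trans (cong (F b) (ℕP.+-∸-assoc 1 b≤n)) (F≡0 b _)))
             (cong (F (suc n)) (ℕP.n∸n≡0 n)))
  (+-identityˡ _)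

sumTo²-cong : ∀ i j {F G : ℕ → ℕ → ℚ} → (∀ a b → F a b ≡ G a b) →
  sumTo i (λ a → sumTo j (λ b → F a b)) ≡ sumTo i (λ a → sumTo j (λ b → G a b))
sumTo²-cong i j F≡G = sumTo-cong i (λ a → sumTo-cong j (λ b → F≡G a b))

sumTo²-+ : ∀ i j (F G : ℕ → ℕ → ℚ) →
  sumTo i (λ a → sumTo j (λ b → F a b + G a b)) ≡
  sumTo i (λ a → sumTo j (λ b → F a b)) + sumTo i (λ a → sumTo j (λ b → G a b))
sumTo²-+ i j F G = trans (sumTo-cong i (λ a → sumTo-+ j (F a) (G a))) (sumTo-+ i _ _)

sumTo²-neg : ∀ i j (F : ℕ → ℕ → ℚ) →
  sumTo i (λ a → sumTo j (λ b → - F a b)) ≡ - sumTo i (λ a → sumTo j (λ b → F a b))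
sumTo²-neg i j F = trans (sumTo-cong i (λ a → sumTo-neg j (F a))) (sumTo-neg i _)

sumTo²-*ˡ : ∀ i j c (F : ℕ → ℕ → ℚ) →
  sumTo i (λ a → sumTo j (λ b → c * F a b)) ≡ c * sumTo i (λ a → sumTo j (λ b → F a b))
sumTo²-*ˡ i j c F = trans (sumTo-cong i (λ a → sumTo-*ˡ j c (F a))) (sumTo-*ˡ i c _)

-- Power series in x and t

infix 4 _≈_
_≈_ : Ser2 → Ser2 → Set
f ≈ g = ∀ i j → f i j ≡ g i j

≈-trans : ∀ {f g h} → f ≈ g → g ≈ h → f ≈ h
≈-trans f≈g g≈h i j = trans (f≈g i j) (g≈h i j)

⊛-congˡ : ∀ {f f′} g → f ≈ f′ → (f ⊛ g) ≈ (f′ ⊛ g)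
⊛-congˡ g f≈f′ i j = sumTo²-cong i j (λ a b → cong (_* g (i ∸ a) (j ∸ b)) (f≈f′ a b))

⊛-congʳ : ∀ f {g g′} → g ≈ g′ → (f ⊛ g) ≈ (f ⊛ g′)
⊛-congʳ f g≈g′ i j = sumTo²-cong i j (λ a b → cong (f a b *_) (g≈g′ (i ∸ a) (j ∸ b)))

⊛-⊖ʳ : ∀ f g h → (f ⊛ (g ⊖ h)) ≈ ((f ⊛ g) ⊖ (f ⊛ h))
⊛-⊖ʳ f g h i j = begin
  sumTo i (λ a → sumTo j (λ b → f a b * (g (i ∸ a) (j ∸ b) + - h (i ∸ a) (j ∸ b))))
    ≡⟨ sumTo²-cong i j (λ a b → *-distribˡ-− (f a b) (g (i ∸ a) (j ∸ b)) (h (i ∸ a) (j ∸ b))) ⟩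
  sumTo i (λ a → sumTo j (λ b → f a b * g (i ∸ a) (j ∸ b) + - (f a b * h (i ∸ a) (j ∸ b))))
    ≡⟨ sumTo²-+ i j _ _ ⟩
  (f ⊛ g) i j + sumTo i (λ a → sumTo j (λ b → - (f a b * h (i ∸ a) (j ∸ b))))
    ≡⟨ cong (λ x → (f ⊛ g) i j + x) (sumTo²-neg i j _) ⟩
  (f ⊛ g) i j + - (f ⊛ h) i j ∎
  where open ≡-Reasoning

⊛-⊖ˡ : ∀ f g h → ((g ⊖ h) ⊛ f) ≈ ((g ⊛ f) ⊖ (h ⊛ f))
⊛-⊖ˡ f g h i j = begin
  sumTo i (λ a → sumTo j (λ b → (g a b + - h a b) * f (i ∸ a) (j ∸ b)))
    ≡⟨ sumTo²-cong i j (λ a b → *-distribʳ-− (f (i ∸ a) (j ∸ b)) (g a b) (h a b)) ⟩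
  sumTo i (λ a → sumTo j (λ b → g a b * f (i ∸ a) (j ∸ b) + - (h a b * f (i ∸ a) (j ∸ b))))
    ≡⟨ sumTo²-+ i j _ _ ⟩
  (g ⊛ f) i j + sumTo i (λ a → sumTo j (λ b → - (h a b * f (i ∸ a) (j ∸ b))))
    ≡⟨ cong (λ x → (g ⊛ f) i j + x) (sumTo²-neg i j _) ⟩
  (g ⊛ f) i j + - (h ⊛ f) i j ∎
  where open ≡-Reasoning

⊛-scalʳ : ∀ f c g → (f ⊛ scal c g) ≈ scal c (f ⊛ g)
⊛-scalʳ f c g i j = trans (sumTo²-cong i j (λ a b → x*yz≡y*xz (f a b) c _))
                          (sumTo²-*ˡ i j c _)

⊛-scalˡ : ∀ f c g → (scal c g ⊛ f) ≈ scal c (g ⊛ f)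
⊛-scalˡ f c g i j = trans (sumTo²-cong i j (λ a b → *-assoc c (g a b) _)) (sumTo²-*ˡ i j c _)

mulX : Ser2 → Ser2
mulX f zero    j = 0ℚ
mulX f (suc i) j = f i j

mulT : Ser2 → Ser2
mulT f i zero    = 0ℚ
mulT f i (suc j) = f i j

mulX-cong : ∀ {f g} → f ≈ g → mulX f ≈ mulX g
mulX-cong f≈g zero    j = refl
mulX-cong f≈g (suc i) j = f≈g i j

mulT-cong : ∀ {f g} → f ≈ g → mulT f ≈ mulT g
mulT-cong f≈g i zero    = refl
mulT-cong f≈g i (suc j) = f≈g i j

mulX-⊛ : ∀ u f → (mulX u ⊛ f) ≈ mulX (u ⊛ f)
mulX-⊛ u f zero    j = sumTo-zero j (λ b _ → *-zeroˡ (f 0 (j ∸ b)))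
mulX-⊛ u f (suc i) j = trans (sumTo-head i _)
  (trans (cong (_+ (u ⊛ f) i j) (sumTo-zero j (λ b _ → *-zeroˡ (f (suc i) (j ∸ b))))) (+-identityˡ _))

mulT-⊛ : ∀ u f → (mulT u ⊛ f) ≈ mulT (u ⊛ f)
mulT-⊛ u f i zero    = sumTo-zero i (λ a _ → *-zeroˡ (f (i ∸ a) 0))
mulT-⊛ u f i (suc j) = sumTo-cong i (λ a → trans (sumTo-head j _)
  (trans (cong (_+ sumTo j (λ b → u a b * f (i ∸ a) (j ∸ b))) (*-zeroˡ (f (i ∸ a) (suc j)))) (+-identityˡ _)))

⊛-mulX : ∀ f u → (f ⊛ mulX u) ≈ mulX (f ⊛ u)
⊛-mulX f u zero    j = sumTo-zero j (λ b _ → *-zeroʳ (f 0 b))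
⊛-mulX f u (suc i) j = sumTo-antidiagonal-suc i (λ a x → sumTo j (λ b → f a b * mulX u x (j ∸ b)))
  (λ a → sumTo-zero j (λ b _ → *-zeroʳ (f a b)))

⊛-mulT : ∀ f u → (f ⊛ mulT u) ≈ mulT (f ⊛ u)
⊛-mulT f u i zero    = sumTo-zero i (λ a _ → *-zeroʳ (f a 0))
⊛-mulT f u i (suc j) = sumTo-cong i (λ a → sumTo-antidiagonal-suc j (λ b y → f a b * mulT u (i ∸ a) y) (λ b → *-zeroʳ (f a b)))

one-suc : ∀ i j → one i (suc j) ≡ 0ℚ
one-suc zero    j = refl
one-suc (suc i) j = refl

⊛-identityˡ : ∀ f → (one ⊛ f) ≈ f
⊛-identityˡ f i j = trans
  (sumTo-first i (λ a → sumTo j (λ b → one a b * f (i ∸ a) (j ∸ b)))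
                 (λ k → sumTo-zero j (λ b _ → *-zeroˡ (f (i ∸ suc k) (j ∸ b)))))
  (trans (sumTo-first j (λ b → one 0 b * f i (j ∸ b)) (λ k → *-zeroˡ (f i (j ∸ suc k)))) (*-identityˡ (f i j)))

⊛-identityʳ : ∀ f → (f ⊛ one) ≈ f
⊛-identityʳ f i j = trans
  (sumTo-cong i (λ a → sumTo-antidiagonal-corner j (λ b y → f a b * one (i ∸ a) y)
                         (λ b k → trans (cong (f a b *_) (one-suc (i ∸ a) k)) (*-zeroʳ (f a b)))))
  (trans (sumTo-antidiagonal-corner i (λ a x → f a j * one x 0) (λ a k → *-zeroʳ (f a j))) (*-identityʳ (f i j)))

X≈mulX-one : X ≈ mulX one
X≈mulX-one zero          j       = refl
X≈mulX-one (suc zero)    zero    = refl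
X≈mulX-one (suc zero)    (suc j) = refl
X≈mulX-one (suc (suc i)) j       = refl

T≈mulT-one : T ≈ mulT one
T≈mulT-one zero    zero          = refl
T≈mulT-one (suc i) zero          = refl
T≈mulT-one zero    (suc zero)    = refl
T≈mulT-one (suc i) (suc zero)    = refl
T≈mulT-one zero    (suc (suc j)) = refl
T≈mulT-one (suc i) (suc (suc j)) = refl

X-⊛ : ∀ f → (X ⊛ f) ≈ mulX f
X-⊛ f = ≈-trans (⊛-congˡ f X≈mulX-one) (≈-trans (mulX-⊛ one f) (mulX-cong (⊛-identityˡ f)))

T-⊛ : ∀ f → (T ⊛ f) ≈ mulT f
T-⊛ f = ≈-trans (⊛-congˡ f T≈mulT-one) (≈-trans (mulT-⊛ one f) (mulT-cong (⊛-identityˡ f)))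

∂t : Ser2 → Ser2
∂t f i j = fromℕ (suc j) * f i (suc j)

leibniz-coeff : ∀ n (u v : ℕ → ℚ) →
  fromℕ (suc n) * sumTo (suc n) (λ b → u b * v (suc n ∸ b)) ≡
  sumTo n (λ b → (fromℕ (suc b) * u (suc b)) * v (n ∸ b)) + sumTo n (λ b → u b * (fromℕ (suc (n ∸ b)) * v (suc (n ∸ b))))
leibniz-coeff n u v = begin
  fromℕ (suc n) * sumTo (suc n) w
    ≡⟨ sym (sumTo-*ˡ (suc n) (fromℕ (suc n)) w) ⟩
  sumTo (suc n) (λ b → fromℕ (suc n) * w b)
    ≡⟨ sumTo-cong-≤ (suc n) (λ b b≤ → trans (cong (λ x → fromℕ x * w b) (sym (ℕP.m+[n∸m]≡n b≤)))
                                            (trans (cong (_* w b) (fromℕ-+ b (suc n ∸ b)))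
                                                   (*-distribʳ-+ (w b) (fromℕ b) (fromℕ (suc n ∸ b))))) ⟩
  sumTo (suc n) (λ b → fromℕ b * w b + fromℕ (suc n ∸ b) * w b)
    ≡⟨ sumTo-+ (suc n) (λ b → fromℕ b * w b) (λ b → fromℕ (suc n ∸ b) * w b) ⟩
  sumTo (suc n) (λ b → fromℕ b * w b) + sumTo (suc n) (λ b → fromℕ (suc n ∸ b) * w b)
    ≡⟨ cong₂ _+_ left right ⟩
  sumTo n (λ b → (fromℕ (suc b) * u (suc b)) * v (n ∸ b)) + sumTo n (λ b → u b * (fromℕ (suc (n ∸ b)) * v (suc (n ∸ b))))
  ∎
  where
  open ≡-Reasoning
  w : ℕ → ℚ
  w b = u b * v (suc n ∸ b)
  left : sumTo (suc n) (λ b → fromℕ b * w b) ≡ sumTo n (λ b → (fromℕ (suc b) * u (suc b)) * v (n ∸ b))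
  left = trans (sumTo-head n (λ b → fromℕ b * w b))
    (trans (cong₂ _+_ (*-zeroˡ (w 0)) (sumTo-cong n (λ b → sym (*-assoc (fromℕ (suc b)) (u (suc b)) (v (n ∸ b))))))
           (+-identityˡ _))
  right : sumTo (suc n) (λ b → fromℕ (suc n ∸ b) * w b) ≡ sumTo n (λ b → u b * (fromℕ (suc (n ∸ b)) * v (suc (n ∸ b))))
  right = trans (sumTo-antidiagonal-suc n (λ b x → fromℕ x * (u b * v x)) (λ b → *-zeroˡ (u b * v 0)))
    (sumTo-cong n (λ b → x*yz≡y*xz (fromℕ (suc (n ∸ b))) (u b) (v (suc (n ∸ b)))))

∂t-⊛ : ∀ f g → ∂t (f ⊛ g) ≈ (∂t f ⊛ g) ⊕ (f ⊛ ∂t g)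
∂t-⊛ f g i j = trans (sym (sumTo-*ˡ i (fromℕ (suc j)) (λ a → sumTo (suc j) (λ b → f a b * g (i ∸ a) (suc j ∸ b)))))
  (trans (sumTo-cong i (λ a → leibniz-coeff j (f a) (g (i ∸ a))))
         (sumTo-+ i (λ a → sumTo j (λ b → ∂t f a b * g (i ∸ a) (j ∸ b)))
                    (λ a → sumTo j (λ b → f a b * ∂t g (i ∸ a) (j ∸ b)))))

-- Substitution into a series without constant term

[i∸a]+[j∸b]<k : ∀ {i j a b k} → a ≤ i → b ≤ j → i ℕ.+ j < suc k → 1 ≤ a ℕ.+ b → (i ∸ a) ℕ.+ (j ∸ b) < k
[i∸a]+[j∸b]<k {i} {j} {a} {b} {k} a≤i b≤j i+j<1+k 1≤a+b = ℕP.≤-trans (begin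
  suc ((i ∸ a) ℕ.+ (j ∸ b))           ≡⟨ ℕP.+-comm 1 ((i ∸ a) ℕ.+ (j ∸ b)) ⟩
  ((i ∸ a) ℕ.+ (j ∸ b)) ℕ.+ 1         ≤⟨ ℕP.+-monoʳ-≤ ((i ∸ a) ℕ.+ (j ∸ b)) 1≤a+b ⟩
  ((i ∸ a) ℕ.+ (j ∸ b)) ℕ.+ (a ℕ.+ b) ≡⟨ +-interchange (i ∸ a) (j ∸ b) a b ⟩
  ((i ∸ a) ℕ.+ a) ℕ.+ ((j ∸ b) ℕ.+ b) ≡⟨ cong₂ ℕ._+_ (ℕP.m∸n+n≡m a≤i) (ℕP.m∸n+n≡m b≤j) ⟩
  i ℕ.+ j                             ∎) (ℕP.≤-pred i+j<1+k)
  where open ℕP.≤-Reasoning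

pow-vanishes : ∀ g → g 0 0 ≡ 0ℚ → ∀ k i j → i ℕ.+ j < k → pow g k i j ≡ 0ℚ
pow-vanishes g g₀₀≡0 (suc k) i j i+j<1+k = sumTo-zero i (λ a a≤i → sumTo-zero j (λ b b≤j → term a b a≤i b≤j))
  where
  term : ∀ a b → a ≤ i → b ≤ j → g a b * pow g k (i ∸ a) (j ∸ b) ≡ 0ℚ
  term zero    zero    _   _   = trans (cong (_* pow g k i j) g₀₀≡0) (*-zeroˡ (pow g k i j))
  term (suc a) b       a≤i b≤j = trans (cong (g (suc a) b *_)
    (pow-vanishes g g₀₀≡0 k (i ∸ suc a) (j ∸ b) ([i∸a]+[j∸b]<k a≤i b≤j i+j<1+k (s≤s z≤n)))) (*-zeroʳ (g (suc a) b))
  term zero    (suc b) a≤i b≤j = trans (cong (g zero (suc b) *_)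
    (pow-vanishes g g₀₀≡0 k i (j ∸ suc b) ([i∸a]+[j∸b]<k a≤i b≤j i+j<1+k (s≤s z≤n)))) (*-zeroʳ (g zero (suc b)))

pow-suc-vanishes-t⁰ : ∀ g → (∀ a → g a 0 ≡ 0ℚ) → ∀ k i → pow g (suc k) i 0 ≡ 0ℚ
pow-suc-vanishes-t⁰ g g-t⁰≡0 k i =
  sumTo-zero i (λ a _ → trans (cong (_* pow g k (i ∸ a) 0) (g-t⁰≡0 a)) (*-zeroˡ (pow g k (i ∸ a) 0)))

subst-extend : ∀ h g → g 0 0 ≡ 0ℚ → ∀ i j N → i ℕ.+ j ≤ N → subst h g i j ≡ sumTo N (λ k → h k * pow g k i j)
subst-extend h g g₀₀≡0 i j N i+j≤N = sym (sumTo-extend (i ℕ.+ j) N (λ k → h k * pow g k i j) i+j≤N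
  (λ k i+j<k → trans (cong (h k *_) (pow-vanishes g g₀₀≡0 k i j i+j<k)) (*-zeroʳ (h k))))

subst-cong : ∀ {h h′} g → (∀ k → h k ≡ h′ k) → subst h g ≈ subst h′ g
subst-cong g h≡h′ i j = sumTo-cong (i ℕ.+ j) (λ k → cong (_* _) (h≡h′ k))

subst-⊖ : ∀ h₁ h₂ g → subst (λ k → h₁ k + - h₂ k) g ≈ (subst h₁ g ⊖ subst h₂ g)
subst-⊖ h₁ h₂ g i j = trans
  (sumTo-cong (i ℕ.+ j) (λ k → *-distribʳ-− (pow g k i j) (h₁ k) (h₂ k)))
  (trans (sumTo-+ (i ℕ.+ j) _ _) (cong (λ x → subst h₁ g i j + x) (sumTo-neg (i ℕ.+ j) _)))

subst-scal : ∀ c h g → subst (λ k → c * h k) g ≈ scal c (subst h g)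
subst-scal c h g i j = trans (sumTo-cong (i ℕ.+ j) (λ k → *-assoc c (h k) _)) (sumTo-*ˡ (i ℕ.+ j) c _)

one₁ : Ser1
one₁ zero    = 1ℚ
one₁ (suc _) = 0ℚ

subst-one₁ : ∀ g → subst one₁ g ≈ one
subst-one₁ g i j = trans (sumTo-first (i ℕ.+ j) _ (λ k → *-zeroˡ (pow g (suc k) i j))) (*-identityˡ _)

mulX₁ : Ser1 → Ser1
mulX₁ h zero    = 0ℚ
mulX₁ h (suc k) = h k

subst-mulX₁ : ∀ h g → g 0 0 ≡ 0ℚ → subst (mulX₁ h) g ≈ (g ⊛ subst h g)
subst-mulX₁ h g g₀₀≡0 i j = begin
  subst (mulX₁ h) g i j
    ≡⟨ subst-extend (mulX₁ h) g g₀₀≡0 i j (suc N) (ℕP.n≤1+n N) ⟩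
  sumTo (suc N) (λ k → mulX₁ h k * pow g k i j)
    ≡⟨ trans (sumTo-head N (λ k → mulX₁ h k * pow g k i j))
             (trans (cong (_+ sumTo N (λ k → h k * (g ⊛ pow g k) i j)) (*-zeroˡ (one i j))) (+-identityˡ _)) ⟩
  sumTo N (λ k → h k * (g ⊛ pow g k) i j)
    ≡⟨ sumTo-cong N (λ k → sym (sumTo²-*ˡ i j (h k) (λ a b → g a b * pow g k (i ∸ a) (j ∸ b)))) ⟩
  sumTo N (λ k → sumTo i (λ a → sumTo j (λ b → h k * (g a b * pow g k (i ∸ a) (j ∸ b)))))
    ≡⟨ trans (sumTo-swap N i _) (sumTo-cong i (λ a → sumTo-swap N j _)) ⟩
  sumTo i (λ a → sumTo j (λ b → sumTo N (λ k → h k * (g a b * pow g k (i ∸ a) (j ∸ b)))))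
    ≡⟨ sumTo²-cong i j (λ a b → trans (sumTo-cong N (λ k → x*yz≡y*xz (h k) (g a b) _))
                                      (sumTo-*ˡ N (g a b) _)) ⟩
  sumTo i (λ a → sumTo j (λ b → g a b * sumTo N (λ k → h k * pow g k (i ∸ a) (j ∸ b))))
    ≡⟨ sumTo-cong-≤ i (λ a a≤i → sumTo-cong-≤ j (λ b b≤j → cong (g a b *_) (sym (subst-extend h g g₀₀≡0 (i ∸ a) (j ∸ b) N
          (ℕP.+-mono-≤ (ℕP.m∸n≤m i a) (ℕP.m∸n≤m j b)))))) ⟩
  (g ⊛ subst h g) i j ∎
  where
  open ≡-Reasoning
  N = i ℕ.+ j

mulX-subst : ∀ h g → g 0 0 ≡ 0ℚ → ∀ i j → mulX (subst h g) i j ≡ sumTo (i ℕ.+ j) (λ k → h k * mulX (pow g k) i j)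
mulX-subst h g g₀₀≡0 zero    j = sym (sumTo-zero j (λ k _ → *-zeroʳ (h k)))
mulX-subst h g g₀₀≡0 (suc i) j = subst-extend h g g₀₀≡0 i j (suc i ℕ.+ j) (ℕP.n≤1+n _)

mulT-subst : ∀ h g → g 0 0 ≡ 0ℚ → ∀ i j → mulT (subst h g) i j ≡ sumTo (i ℕ.+ j) (λ k → h k * mulT (pow g k) i j)
mulT-subst h g g₀₀≡0 i zero    = sym (sumTo-zero (i ℕ.+ 0) (λ k _ → *-zeroʳ (h k)))
mulT-subst h g g₀₀≡0 i (suc j) =
  subst-extend h g g₀₀≡0 i j (i ℕ.+ suc j) (ℕP.≤-trans (ℕP.n≤1+n _) (ℕP.≤-reflexive (sym (ℕP.+-suc i j))))

-- The generating function e^{2xt−t²} and the Hermite recurrence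

two : ℚ
two = fromℕ 2

exponent : Ser2
exponent = scal two (X ⊛ T) ⊖ pow T 2

twice[x−t] : Ser2 → Ser2
twice[x−t] h = scal two (mulX h) ⊖ scal two (mulT h)

exponent≈ : exponent ≈ scal two (mulX (mulT one)) ⊖ mulT (mulT one)
exponent≈ i j = cong₂ (λ x y → two * x + - y)
  (trans (X-⊛ T i j) (mulX-cong T≈mulT-one i j))
  (trans (T-⊛ (T ⊛ one) i j) (mulT-cong (T-⊛ one) i j))

exponent-t⁰ : ∀ a → exponent a 0 ≡ 0ℚ
exponent-t⁰ zero    = exponent≈ 0 0
exponent-t⁰ (suc a) = exponent≈ (suc a) 0

∂t-exponent : ∂t exponent ≈ twice[x−t] one
∂t-exponent i j = trans (cong (fromℕ (suc j) *_) (exponent≈ i (suc j))) (explicit i j)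
  where
  0≡ : ∀ n → fromℕ n * (two * 0ℚ + - 0ℚ) ≡ two * 0ℚ + - (two * 0ℚ)
  0≡ n = *-zeroʳ (fromℕ n)
  explicit : ∂t (scal two (mulX (mulT one)) ⊖ mulT (mulT one)) ≈ twice[x−t] one
  explicit zero          zero          = refl
  explicit zero          (suc zero)    = refl
  explicit zero          (suc (suc j)) = 0≡ (suc (suc (suc j)))
  explicit (suc zero)    zero          = refl
  explicit (suc (suc i)) zero          = 0≡ 1
  explicit (suc zero)    (suc j)       = 0≡ (suc (suc j))
  explicit (suc (suc i)) (suc j)       = 0≡ (suc (suc j))

twice[x−t]-one-⊛ : ∀ h → (twice[x−t] one ⊛ h) ≈ twice[x−t] h
twice[x−t]-one-⊛ h i j = trans (⊛-⊖ˡ h (scal two (mulX one)) (scal two (mulT one)) i j)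
  (cong₂ (λ x y → x + - y)
    (trans (⊛-scalˡ h two (mulX one) i j) (cong (two *_) (trans (mulX-⊛ one h i j) (mulX-cong (⊛-identityˡ h) i j))))
    (trans (⊛-scalˡ h two (mulT one) i j) (cong (two *_) (trans (mulT-⊛ one h i j) (mulT-cong (⊛-identityˡ h) i j)))))

⊛-twice[x−t] : ∀ g h → (g ⊛ twice[x−t] h) ≈ twice[x−t] (g ⊛ h)
⊛-twice[x−t] g h i j = trans (⊛-⊖ʳ g (scal two (mulX h)) (scal two (mulT h)) i j)
  (cong₂ (λ x y → x + - y)
    (trans (⊛-scalʳ g two (mulX h) i j) (cong (two *_) (⊛-mulX g h i j)))
    (trans (⊛-scalʳ g two (mulT h) i j) (cong (two *_) (⊛-mulT g h i j))))

∂t-pow-exponent : ∀ k → ∂t (pow exponent (suc k)) ≈ scal (fromℕ (suc k)) (twice[x−t] (pow exponent k))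
∂t-pow-exponent zero i j = begin
  fromℕ (suc j) * (exponent ⊛ one) i (suc j) ≡⟨ cong (fromℕ (suc j) *_) (⊛-identityʳ exponent i (suc j)) ⟩
  ∂t exponent i j                            ≡⟨ ∂t-exponent i j ⟩
  twice[x−t] one i j                         ≡⟨ sym (*-identityˡ (twice[x−t] one i j)) ⟩
  1ℚ * twice[x−t] one i j                    ∎
  where open ≡-Reasoning
∂t-pow-exponent (suc k) i j = begin
  ∂t (exponent ⊛ p) i j
    ≡⟨ ∂t-⊛ exponent p i j ⟩
  (∂t exponent ⊛ p) i j + (exponent ⊛ ∂t p) i j
    ≡⟨ cong₂ _+_ (trans (⊛-congˡ p ∂t-exponent i j) (twice[x−t]-one-⊛ p i j)) chain ⟩
  twice[x−t] p i j + fromℕ (suc k) * twice[x−t] p i j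
    ≡⟨ solve 2 (λ x y → x :+ y :* x := (con 1ℚ :+ y) :* x) refl (twice[x−t] p i j) (fromℕ (suc k)) ⟩
  (1ℚ + fromℕ (suc k)) * twice[x−t] p i j
    ≡⟨ cong (_* twice[x−t] p i j) (sym (fromℕ-suc (suc k))) ⟩
  fromℕ (suc (suc k)) * twice[x−t] p i j ∎
  where
  open ≡-Reasoning
  p = pow exponent (suc k)
  chain : (exponent ⊛ ∂t p) i j ≡ fromℕ (suc k) * twice[x−t] p i j
  chain = trans (⊛-congʳ exponent (∂t-pow-exponent k) i j)
    (trans (⊛-scalʳ exponent (fromℕ (suc k)) (twice[x−t] (pow exponent k)) i j)
           (cong (fromℕ (suc k) *_) (⊛-twice[x−t] exponent (pow exponent k) i j)))

twice[x−t]-subst : ∀ h g → g 0 0 ≡ 0ℚ → ∀ i j →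
  sumTo (i ℕ.+ j) (λ k → h k * twice[x−t] (pow g k) i j) ≡ twice[x−t] (subst h g) i j
twice[x−t]-subst h g g₀₀≡0 i j = begin
  sumTo N (λ k → h k * (two * x k + - (two * t k)))
    ≡⟨ sumTo-cong N (λ k → *-scaled-difference (h k) two (x k) (t k)) ⟩
  sumTo N (λ k → two * (h k * x k) + - (two * (h k * t k)))
    ≡⟨ sumTo-+ N (λ k → two * (h k * x k)) (λ k → - (two * (h k * t k))) ⟩
  sumTo N (λ k → two * (h k * x k)) + sumTo N (λ k → - (two * (h k * t k)))
    ≡⟨ cong₂ _+_ (sumTo-*ˡ N two _) (trans (sumTo-neg N _) (cong -_ (sumTo-*ˡ N two _))) ⟩
  two * sumTo N (λ k → h k * x k) + - (two * sumTo N (λ k → h k * t k))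
    ≡⟨ sym (cong₂ (λ a b → two * a + - (two * b)) (mulX-subst h g g₀₀≡0 i j) (mulT-subst h g g₀₀≡0 i j)) ⟩
  twice[x−t] (subst h g) i j ∎
  where
  open ≡-Reasoning
  N = i ℕ.+ j
  x t : ℕ → ℚ
  x k = mulX (pow g k) i j
  t k = mulT (pow g k) i j

∂t-genH : ∂t genH ≈ twice[x−t] genH
∂t-genH i j = begin
  fromℕ (suc j) * sumTo (i ℕ.+ suc j) c
    ≡⟨ cong (λ M → fromℕ (suc j) * sumTo M c) (ℕP.+-suc i j) ⟩
  fromℕ (suc j) * sumTo (suc N) c
    ≡⟨ cong (fromℕ (suc j) *_) (trans (sumTo-head N c) (trans (cong (_+ sumTo N (λ k → c (suc k))) c₀≡0) (+-identityˡ _))) ⟩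
  fromℕ (suc j) * sumTo N (λ k → c (suc k))
    ≡⟨ sym (sumTo-*ˡ N (fromℕ (suc j)) (λ k → c (suc k))) ⟩
  sumTo N (λ k → fromℕ (suc j) * c (suc k))
    ≡⟨ sumTo-cong N term ⟩
  sumTo N (λ k → invFact k * twice[x−t] (pow exponent k) i j)
    ≡⟨ twice[x−t]-subst invFact exponent (exponent-t⁰ 0) i j ⟩
  twice[x−t] genH i j ∎
  where
  open ≡-Reasoning
  N = i ℕ.+ j
  c : ℕ → ℚ
  c k = invFact k * pow exponent k i (suc j)
  c₀≡0 : c 0 ≡ 0ℚ
  c₀≡0 = trans (cong (invFact 0 *_) (one-suc i j)) (*-zeroʳ (invFact 0))
  term : ∀ k → fromℕ (suc j) * c (suc k) ≡ invFact k * twice[x−t] (pow exponent k) i j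
  term k = begin
    fromℕ (suc j) * (invFact (suc k) * pow exponent (suc k) i (suc j))
      ≡⟨ x*yz≡y*xz (fromℕ (suc j)) (invFact (suc k)) _ ⟩
    invFact (suc k) * ∂t (pow exponent (suc k)) i j
      ≡⟨ cong (invFact (suc k) *_) (∂t-pow-exponent k i j) ⟩
    invFact (suc k) * (fromℕ (suc k) * twice[x−t] (pow exponent k) i j)
      ≡⟨ sym (*-assoc (invFact (suc k)) _ _) ⟩
    invFact (suc k) * fromℕ (suc k) * twice[x−t] (pow exponent k) i j
      ≡⟨ cong (_* twice[x−t] (pow exponent k) i j) (invFact-suc k) ⟩
    invFact k * twice[x−t] (pow exponent k) i j ∎

egf : Ser2 → Ser2
egf f i j = fromℕ (j !) * f i j

invFact-*-egf : ∀ f i j → invFact j * egf f i j ≡ f i j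
invFact-*-egf f i j = trans (sym (*-assoc (invFact j) (fromℕ (j !)) (f i j)))
  (trans (cong (_* f i j) (invFact-*-! j)) (*-identityˡ (f i j)))

egf-suc : ∀ f i k → egf f i (suc k) ≡ fromℕ (k !) * ∂t f i k
egf-suc f i k = trans (cong (_* f i (suc k)) (fromℕ-! k))
  (solve 3 (λ a b c → a :* b :* c := b :* (a :* c)) refl (fromℕ (suc k)) (fromℕ (k !)) (f i (suc k)))

egf-mulT : ∀ f i j → egf (mulT f) i j ≡ fromℕ j * egf f i (j ∸ 1)
egf-mulT f i zero    = trans (*-zeroʳ (fromℕ 1)) (sym (*-zeroˡ (egf f i 0)))
egf-mulT f i (suc j) = trans (cong (_* f i j) (fromℕ-! j)) (*-assoc (fromℕ (suc j)) (fromℕ (j !)) (f i j))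

egf-genH-suc : ∀ i k → egf genH i (suc k) ≡ two * egf (mulX genH) i k + - (two * egf (mulT genH) i k)
egf-genH-suc i k = begin
  egf genH i (suc k)                                              ≡⟨ egf-suc genH i k ⟩
  fromℕ (k !) * ∂t genH i k                                       ≡⟨ cong (fromℕ (k !) *_) (∂t-genH i k) ⟩
  fromℕ (k !) * (two * mulX genH i k + - (two * mulT genH i k))   ≡⟨ *-scaled-difference (fromℕ (k !)) two (mulX genH i k) (mulT genH i k) ⟩
  two * egf (mulX genH) i k + - (two * egf (mulT genH) i k)       ∎
  where open ≡-Reasoning

genH-t⁰ : ∀ i → genH i 0 ≡ one i 0
genH-t⁰ i = trans (sumTo-first (i ℕ.+ 0) (λ k → invFact k * pow exponent k i 0)
                     (λ k → trans (cong (invFact (suc k) *_) (pow-suc-vanishes-t⁰ exponent exponent-t⁰ k i)) (*-zeroʳ (invFact (suc k)))))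
                  (*-identityˡ (one i 0))

H-zero : ∀ i → H 0 i ≡ one₁ i
H-zero zero    = cong (fromℕ 1 *_) (genH-t⁰ 0)
H-zero (suc i) = cong (fromℕ 1 *_) (genH-t⁰ (suc i))

-- At n = 0 the junk value H (0 ∸ 1) = H 0 is killed by the factor fromℕ 0.
H-suc : ∀ n i → H (suc n) i ≡ two * mulX₁ (H n) i + - (two * (fromℕ n * H (n ∸ 1) i))
H-suc n i = trans (egf-genH-suc i n) (cong₂ (λ a b → two * a + - (two * b)) (mulX-part i) (egf-mulT genH i n))
  where
  mulX-part : ∀ i → egf (mulX genH) i n ≡ mulX₁ (H n) i
  mulX-part zero    = *-zeroʳ (fromℕ (n !))
  mulX-part (suc i) = refl

-- e^{2xt−t²} H_n(x − t) as the n-th t-derivative of e^{2xt−t²}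

x−t : Ser2
x−t = X ⊖ T

x−t-⊛ : ∀ f → (x−t ⊛ f) ≈ (mulX f ⊖ mulT f)
x−t-⊛ f i j = trans (⊛-⊖ˡ f X T i j) (cong₂ (λ x y → x + - y) (X-⊛ f i j) (T-⊛ f i j))

H[x−t] : ℕ → Ser2
H[x−t] n = subst (H n) x−t

H[x−t]-zero : H[x−t] 0 ≈ one
H[x−t]-zero = ≈-trans (subst-cong x−t H-zero) (subst-one₁ x−t)

H[x−t]-suc : ∀ n → H[x−t] (suc n) ≈ (twice[x−t] (H[x−t] n) ⊖ scal two (scal (fromℕ n) (H[x−t] (n ∸ 1))))
H[x−t]-suc n i j = begin
  H[x−t] (suc n) i j
    ≡⟨ subst-cong x−t (H-suc n) i j ⟩
  subst (λ k → two * mulX₁ (H n) k + - (two * (fromℕ n * H (n ∸ 1) k))) x−t i j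
    ≡⟨ subst-⊖ (λ k → two * mulX₁ (H n) k) (λ k → two * (fromℕ n * H (n ∸ 1) k)) x−t i j ⟩
  subst (λ k → two * mulX₁ (H n) k) x−t i j + - subst (λ k → two * (fromℕ n * H (n ∸ 1) k)) x−t i j
    ≡⟨ cong₂ (λ a b → a + - b) mulX₁-part n-part ⟩
  twice[x−t] P i j + - (two * (fromℕ n * H[x−t] (n ∸ 1) i j)) ∎
  where
  open ≡-Reasoning
  P = H[x−t] n
  mulX₁-part : subst (λ k → two * mulX₁ (H n) k) x−t i j ≡ twice[x−t] P i j
  mulX₁-part = trans (subst-scal two (mulX₁ (H n)) x−t i j)
    (trans (cong (two *_) (trans (subst-mulX₁ (H n) x−t refl i j) (x−t-⊛ P i j)))
           (*-distribˡ-− two (mulX P i j) (mulT P i j)))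
  n-part : subst (λ k → two * (fromℕ n * H (n ∸ 1) k)) x−t i j ≡ two * (fromℕ n * H[x−t] (n ∸ 1) i j)
  n-part = trans (subst-scal two (λ k → fromℕ n * H (n ∸ 1) k) x−t i j) (cong (two *_) (subst-scal (fromℕ n) (H (n ∸ 1)) x−t i j))

E : ℕ → Ser2
E n = genH ⊛ H[x−t] n

E-zero : E 0 ≈ genH
E-zero = ≈-trans (⊛-congʳ genH H[x−t]-zero) (⊛-identityʳ genH)

E-suc : ∀ n → E (suc n) ≈ (twice[x−t] (E n) ⊖ scal two (scal (fromℕ n) (E (n ∸ 1))))
E-suc n i j = begin
  E (suc n) i j
    ≡⟨ ⊛-congʳ genH (H[x−t]-suc n) i j ⟩
  (genH ⊛ (twice[x−t] P ⊖ scal two (scal (fromℕ n) P′))) i j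
    ≡⟨ ⊛-⊖ʳ genH (twice[x−t] P) (scal two (scal (fromℕ n) P′)) i j ⟩
  (genH ⊛ twice[x−t] P) i j + - (genH ⊛ scal two (scal (fromℕ n) P′)) i j
    ≡⟨ cong₂ (λ a b → a + - b) (⊛-twice[x−t] genH P i j)
             (trans (⊛-scalʳ genH two (scal (fromℕ n) P′) i j) (cong (two *_) (⊛-scalʳ genH (fromℕ n) P′ i j))) ⟩
  twice[x−t] (E n) i j + - (two * (fromℕ n * E (n ∸ 1) i j)) ∎
  where
  open ≡-Reasoning
  P  = H[x−t] n
  P′ = H[x−t] (n ∸ 1)

-- E n = ∂_t^n genH, stated on egf coefficients.
EgfShift : ℕ → Set
EgfShift n = ∀ i j → egf (E n) i j ≡ egf genH i (j ℕ.+ n)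

egfShift-zero : EgfShift 0
egfShift-zero i j = trans (cong (fromℕ (j !) *_) (E-zero i j)) (cong (egf genH i) (sym (ℕP.+-identityʳ j)))

-- The weight vanishes exactly where the truncated subtraction goes wrong.
*-index-[j∸1]+n : ∀ j n (a : ℕ → ℚ) → fromℕ j * a ((j ∸ 1) ℕ.+ n) ≡ fromℕ j * a (j ℕ.+ n ∸ 1)
*-index-[j∸1]+n zero    n a = trans (*-zeroˡ (a n)) (sym (*-zeroˡ (a (n ∸ 1))))
*-index-[j∸1]+n (suc j) n a = refl

*-index-j+[n∸1] : ∀ j n (a : ℕ → ℚ) → fromℕ n * a (j ℕ.+ (n ∸ 1)) ≡ fromℕ n * a (j ℕ.+ n ∸ 1)
*-index-j+[n∸1] j zero    a = trans (*-zeroˡ (a (j ℕ.+ 0))) (sym (*-zeroˡ (a (j ℕ.+ 0 ∸ 1))))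
*-index-j+[n∸1] j (suc n) a = cong (λ k → fromℕ (suc n) * a k) (sym (ℕP.+-∸-assoc j (s≤s (z≤n {n}))))

egf-E-suc : ∀ n i j → egf (E (suc n)) i j ≡
  two * egf (mulX (E n)) i j + - (two * (egf (mulT (E n)) i j + fromℕ n * egf (E (n ∸ 1)) i j))
egf-E-suc n i j = trans (cong (fromℕ (j !) *_) (E-suc n i j))
  (solve 6 (λ f w a b c d → f :* (w :* a :+ :- (w :* b) :+ :- (w :* (c :* d)))
                         := w :* (f :* a) :+ :- (w :* (f :* b :+ c :* (f :* d))))
     refl (fromℕ (j !)) two (mulX (E n) i j) (mulT (E n) i j) (fromℕ n) (E (n ∸ 1) i j))

egfShift-suc : ∀ n → EgfShift (n ∸ 1) → EgfShift n → EgfShift (suc n)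
egfShift-suc n shift[n∸1] shift[n] i j = begin
  egf (E (suc n)) i j
    ≡⟨ egf-E-suc n i j ⟩
  two * egf (mulX (E n)) i j + - (two * (egf (mulT (E n)) i j + fromℕ n * egf (E (n ∸ 1)) i j))
    ≡⟨ cong₂ (λ a b → two * a + - (two * b)) (mulX-part i) mulT-part ⟩
  two * egf (mulX genH) i (j ℕ.+ n) + - (two * egf (mulT genH) i (j ℕ.+ n))
    ≡⟨ sym (egf-genH-suc i (j ℕ.+ n)) ⟩
  egf genH i (suc (j ℕ.+ n))
    ≡⟨ cong (egf genH i) (sym (ℕP.+-suc j n)) ⟩
  egf genH i (j ℕ.+ suc n) ∎
  where
  open ≡-Reasoning
  mulX-part : ∀ i → egf (mulX (E n)) i j ≡ egf (mulX genH) i (j ℕ.+ n)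
  mulX-part zero    = trans (*-zeroʳ (fromℕ (j !))) (sym (*-zeroʳ (fromℕ ((j ℕ.+ n) !))))
  mulX-part (suc i) = shift[n] i j
  g : ℕ → ℚ
  g = egf genH i
  mulT-part : egf (mulT (E n)) i j + fromℕ n * egf (E (n ∸ 1)) i j ≡ egf (mulT genH) i (j ℕ.+ n)
  mulT-part = begin
    egf (mulT (E n)) i j + fromℕ n * egf (E (n ∸ 1)) i j
      ≡⟨ cong₂ _+_ (trans (egf-mulT (E n) i j) (cong (fromℕ j *_) (shift[n] i (j ∸ 1))))
                   (cong (fromℕ n *_) (shift[n∸1] i j)) ⟩
    fromℕ j * g ((j ∸ 1) ℕ.+ n) + fromℕ n * g (j ℕ.+ (n ∸ 1))
      ≡⟨ cong₂ _+_ (*-index-[j∸1]+n j n g) (*-index-j+[n∸1] j n g) ⟩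
    fromℕ j * g (j ℕ.+ n ∸ 1) + fromℕ n * g (j ℕ.+ n ∸ 1)
      ≡⟨ sym (trans (cong (_* g (j ℕ.+ n ∸ 1)) (fromℕ-+ j n)) (*-distribʳ-+ (g (j ℕ.+ n ∸ 1)) (fromℕ j) (fromℕ n))) ⟩
    fromℕ (j ℕ.+ n) * g (j ℕ.+ n ∸ 1)
      ≡⟨ sym (egf-mulT genH i (j ℕ.+ n)) ⟩
    egf (mulT genH) i (j ℕ.+ n) ∎

egfShift : ∀ n → EgfShift n
egfShift n = proj₂ (consecutive n)
  where
  consecutive : ∀ n → EgfShift (n ∸ 1) × EgfShift n
  consecutive zero    = egfShift-zero , egfShift-zero
  consecutive (suc n) with consecutive n
  ... | shift[n∸1] , shift[n] = shift[n] , egfShift-suc n shift[n∸1] shift[n]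

E-coeff : ∀ n i j → n ≤ j → E n i (j ∸ n) ≡ invFact (j ∸ n) * egf genH i j
E-coeff n i j n≤j = begin
  E n i (j ∸ n)                              ≡⟨ sym (invFact-*-egf (E n) i (j ∸ n)) ⟩
  invFact (j ∸ n) * egf (E n) i (j ∸ n)      ≡⟨ cong (invFact (j ∸ n) *_) (egfShift n i (j ∸ n)) ⟩
  invFact (j ∸ n) * egf genH i (j ∸ n ℕ.+ n) ≡⟨ cong (λ k → invFact (j ∸ n) * egf genH i k) (ℕP.m∸n+n≡m n≤j) ⟩
  invFact (j ∸ n) * egf genH i j             ∎
  where open ≡-Reasoning

-- Stirling numbers

fromℕ-S-suc : ∀ n k → fromℕ (S (suc n) (suc k)) ≡ fromℕ (suc k) * fromℕ (S n (suc k)) + fromℕ (S n k)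
fromℕ-S-suc n k = trans (fromℕ-+ (suc k ℕ.* S n (suc k)) (S n k)) (cong (_+ fromℕ (S n k)) (fromℕ-* (suc k) (S n (suc k))))

binomial-S : ℕ → ℕ → ℚ
binomial-S j m = sumTo j (λ n → fromℕ (j C n) * fromℕ (S n m))

binomial-S-suc : ∀ j m → binomial-S (suc j) m ≡ binomial-S j m + sumTo j (λ n → fromℕ (j C n) * fromℕ (S (suc n) m))
binomial-S-suc j m = begin
  binomial-S (suc j) m
    ≡⟨ sumTo-head j (λ n → fromℕ (suc j C n) * fromℕ (S n m)) ⟩
  c₀ + sumTo j (λ n → fromℕ (suc j C suc n) * s (suc n))
    ≡⟨ cong (λ x → c₀ + x) (trans (sumTo-cong j pascal)
                                  (sumTo-+ j (λ n → fromℕ (j C n) * s (suc n)) (λ n → fromℕ (j C suc n) * s (suc n)))) ⟩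
  c₀ + (B′ + sumTo j (λ n → fromℕ (j C suc n) * s (suc n)))
    ≡⟨ solve 3 (λ a b c → a :+ (b :+ c) := (a :+ c) :+ b) refl c₀ B′ (sumTo j (λ n → fromℕ (j C suc n) * s (suc n))) ⟩
  (c₀ + sumTo j (λ n → fromℕ (j C suc n) * s (suc n))) + B′
    ≡⟨ cong (_+ B′) (sym (sumTo-head j (λ n → fromℕ (j C n) * s n))) ⟩
  sumTo (suc j) (λ n → fromℕ (j C n) * s n) + B′
    ≡⟨ cong (λ x → (binomial-S j m + x) + B′) C[j,1+j]≡0 ⟩
  (binomial-S j m + 0ℚ) + B′
    ≡⟨ cong (_+ B′) (+-identityʳ (binomial-S j m)) ⟩
  binomial-S j m + B′ ∎
  where
  open ≡-Reasoning
  s : ℕ → ℚ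
  s n = fromℕ (S n m)
  c₀ = fromℕ (j C 0) * s 0
  B′ = sumTo j (λ n → fromℕ (j C n) * s (suc n))
  pascal : ∀ n → fromℕ (suc j C suc n) * s (suc n) ≡ fromℕ (j C n) * s (suc n) + fromℕ (j C suc n) * s (suc n)
  pascal n = trans (cong (λ c → fromℕ c * s (suc n)) (sym (nCk+nC[k+1]≡[n+1]C[k+1] j n)))
    (trans (cong (_* s (suc n)) (fromℕ-+ (j C n) (j C suc n))) (*-distribʳ-+ (s (suc n)) (fromℕ (j C n)) (fromℕ (j C suc n))))
  C[j,1+j]≡0 : fromℕ (j C suc j) * s (suc j) ≡ 0ℚ
  C[j,1+j]≡0 = trans (cong (λ c → fromℕ c * s (suc j)) (k>n⇒nCk≡0 (ℕP.n<1+n j))) (*-zeroˡ (s (suc j)))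

binomial-S[1+n] : ∀ j m →
  sumTo j (λ n → fromℕ (j C n) * fromℕ (S (suc n) (suc m))) ≡ fromℕ (suc m) * binomial-S j (suc m) + binomial-S j m
binomial-S[1+n] j m = begin
  sumTo j (λ n → fromℕ (j C n) * fromℕ (S (suc n) (suc m)))
    ≡⟨ sumTo-cong j (λ n → trans (cong (fromℕ (j C n) *_) (fromℕ-S-suc n m))
         (solve 4 (λ c a s t → c :* (a :* s :+ t) := a :* (c :* s) :+ c :* t) refl
                  (fromℕ (j C n)) (fromℕ (suc m)) (fromℕ (S n (suc m))) (fromℕ (S n m)))) ⟩
  sumTo j (λ n → fromℕ (suc m) * (fromℕ (j C n) * fromℕ (S n (suc m))) + fromℕ (j C n) * fromℕ (S n m))
    ≡⟨ sumTo-+ j (λ n → fromℕ (suc m) * (fromℕ (j C n) * fromℕ (S n (suc m)))) (λ n → fromℕ (j C n) * fromℕ (S n m)) ⟩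
  sumTo j (λ n → fromℕ (suc m) * (fromℕ (j C n) * fromℕ (S n (suc m)))) + binomial-S j m
    ≡⟨ cong (_+ binomial-S j m) (sumTo-*ˡ j (fromℕ (suc m)) (λ n → fromℕ (j C n) * fromℕ (S n (suc m)))) ⟩
  fromℕ (suc m) * binomial-S j (suc m) + binomial-S j m ∎
  where open ≡-Reasoning

binomial-S≡S : ∀ j m → binomial-S j m ≡ fromℕ (S (suc j) (suc m))
binomial-S≡S zero    zero    = refl
binomial-S≡S zero    (suc m) = cong fromℕ (sym (trans (ℕP.+-identityʳ _) (ℕP.*-zeroʳ (suc (suc m)))))
binomial-S≡S (suc j) zero    = begin
  binomial-S (suc j) 0
    ≡⟨ binomial-S-suc j 0 ⟩
  binomial-S j 0 + sumTo j (λ n → fromℕ (j C n) * 0ℚ)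
    ≡⟨ trans (cong (binomial-S j 0 +_) (sumTo-zero j (λ n _ → *-zeroʳ (fromℕ (j C n))))) (+-identityʳ _) ⟩
  binomial-S j 0
    ≡⟨ binomial-S≡S j 0 ⟩
  fromℕ (S (suc j) 1)
    ≡⟨ cong fromℕ (sym (trans (ℕP.+-identityʳ (1 ℕ.* S (suc j) 1)) (ℕP.*-identityˡ (S (suc j) 1)))) ⟩
  fromℕ (S (suc (suc j)) 1) ∎
  where open ≡-Reasoning
binomial-S≡S (suc j) (suc m) = begin
  binomial-S (suc j) (suc m)
    ≡⟨ binomial-S-suc j (suc m) ⟩
  binomial-S j (suc m) + sumTo j (λ n → fromℕ (j C n) * fromℕ (S (suc n) (suc m)))
    ≡⟨ cong (binomial-S j (suc m) +_) (binomial-S[1+n] j m) ⟩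
  binomial-S j (suc m) + (fromℕ (suc m) * binomial-S j (suc m) + binomial-S j m)
    ≡⟨ cong₂ (λ x y → x + (fromℕ (suc m) * x + y)) (binomial-S≡S j (suc m)) (binomial-S≡S j m) ⟩
  s₁ + (fromℕ (suc m) * s₁ + s₂)
    ≡⟨ solve 3 (λ a x y → x :+ (a :* x :+ y) := (con 1ℚ :+ a) :* x :+ y) refl (fromℕ (suc m)) s₁ s₂ ⟩
  (1ℚ + fromℕ (suc m)) * s₁ + s₂
    ≡⟨ cong (λ x → x * s₁ + s₂) (sym (fromℕ-suc (suc m))) ⟩
  fromℕ (suc (suc m)) * s₁ + s₂
    ≡⟨ sym (fromℕ-S-suc (suc j) (suc m)) ⟩
  fromℕ (S (suc (suc j)) (suc (suc m))) ∎
  where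
  open ≡-Reasoning
  s₁ = fromℕ (S (suc j) (suc (suc m)))
  s₂ = fromℕ (S (suc j) (suc m))

mulTⁿ : ℕ → Ser2 → Ser2
mulTⁿ zero    f = f
mulTⁿ (suc n) f = mulT (mulTⁿ n f)

powT-⊛ : ∀ n f → (pow T n ⊛ f) ≈ mulTⁿ n f
powT-⊛ zero    f = ⊛-identityˡ f
powT-⊛ (suc n) f = ≈-trans (⊛-congˡ f (T-⊛ (pow T n))) (≈-trans (mulT-⊛ (pow T n) f) (mulT-cong (powT-⊛ n f)))

⊛-mulTⁿ : ∀ g n f → (g ⊛ mulTⁿ n f) ≈ mulTⁿ n (g ⊛ f)
⊛-mulTⁿ g zero    f i j = refl
⊛-mulTⁿ g (suc n) f     = ≈-trans (⊛-mulT g (mulTⁿ n f)) (mulT-cong (⊛-mulTⁿ g n f))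

mulTⁿ-≥ : ∀ n f i j → n ≤ j → mulTⁿ n f i j ≡ f i (j ∸ n)
mulTⁿ-≥ n f i j n≤j = trans (cong (mulTⁿ n f i) (sym (ℕP.m+[n∸m]≡n n≤j))) (at n (j ∸ n))
  where
  at : ∀ n d → mulTⁿ n f i (n ℕ.+ d) ≡ f i d
  at zero    d = refl
  at (suc n) d = at n d

mulTⁿ-< : ∀ n f i j → j < n → mulTⁿ n f i j ≡ 0ℚ
mulTⁿ-< (suc n) f i zero    _         = refl
mulTⁿ-< (suc n) f i (suc j) (s≤s j<n) = mulTⁿ-< n f i j j<n

⊛-sumT : ∀ g F → (∀ n i j → j < n → F n i j ≡ 0ℚ) → ∀ i j → (g ⊛ sumT F) i j ≡ sumTo j (λ n → (g ⊛ F n) i j)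
⊛-sumT g F F≡0 i j = begin
  sumTo i (λ a → sumTo j (λ b → g a b * sumTo (j ∸ b) (λ n → F n (i ∸ a) (j ∸ b))))
    ≡⟨ sumTo²-cong i j (λ a b → cong (g a b *_) (sym (sumTo-extend (j ∸ b) j (λ n → F n (i ∸ a) (j ∸ b)) (ℕP.m∸n≤m j b)
                                                       (λ n j∸b<n → F≡0 n (i ∸ a) (j ∸ b) j∸b<n)))) ⟩
  sumTo i (λ a → sumTo j (λ b → g a b * sumTo j (λ n → F n (i ∸ a) (j ∸ b))))
    ≡⟨ sumTo²-cong i j (λ a b → sym (sumTo-*ˡ j (g a b) (λ n → F n (i ∸ a) (j ∸ b)))) ⟩
  sumTo i (λ a → sumTo j (λ b → sumTo j (λ n → g a b * F n (i ∸ a) (j ∸ b))))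
    ≡⟨ sumTo-cong i (λ a → sumTo-swap j j (λ b n → g a b * F n (i ∸ a) (j ∸ b))) ⟩
  sumTo i (λ a → sumTo j (λ n → sumTo j (λ b → g a b * F n (i ∸ a) (j ∸ b))))
    ≡⟨ sumTo-swap i j (λ a n → sumTo j (λ b → g a b * F n (i ∸ a) (j ∸ b))) ⟩
  sumTo j (λ n → (g ⊛ F n) i j) ∎
  where open ≡-Reasoning

lhs-coeff : ∀ m i j → lhs m i j ≡ fromℕ (S (suc j) (suc m)) * genH i j
lhs-coeff m i j = begin
  lhs m i j
    ≡⟨ sumTo-last j (λ n → c n * (pow T n ⊛ inX (H n)) i j)
         (λ n n<j → trans (cong (c n *_) (trans (powT-⊛ n (inX (H n)) i j)
                                          (trans (mulTⁿ-≥ n (inX (H n)) i j (ℕP.<⇒≤ n<j)) (inX-t⁺ (ℕP.m<n⇒0<n∸m n<j)))))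
                          (*-zeroʳ (c n))) ⟩
  c j * (pow T j ⊛ inX (H j)) i j
    ≡⟨ cong (c j *_) (trans (powT-⊛ j (inX (H j)) i j)
                            (trans (mulTⁿ-≥ j (inX (H j)) i j ℕP.≤-refl) (cong (inX (H j) i) (ℕP.n∸n≡0 j)))) ⟩
  fromℕ (S (suc j) (suc m)) * invFact j * egf genH i j
    ≡⟨ trans (*-assoc (fromℕ (S (suc j) (suc m))) (invFact j) _) (cong (fromℕ (S (suc j) (suc m)) *_) (invFact-*-egf genH i j)) ⟩
  fromℕ (S (suc j) (suc m)) * genH i j ∎
  where
  open ≡-Reasoning
  c : ℕ → ℚ
  c n = fromℕ (S (suc n) (suc m)) * invFact n
  inX-t⁺ : ∀ {h k} → 0 < k → inX h i k ≡ 0ℚ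
  inX-t⁺ {k = suc k} _ = refl

rhs-term : ∀ m n i j → n ≤ j →
  (genH ⊛ scal (fromℕ (S n m) * invFact n) (pow T n ⊛ H[x−t] n)) i j ≡ fromℕ (j C n) * fromℕ (S n m) * genH i j
rhs-term m n i j n≤j = begin
  (genH ⊛ scal c (pow T n ⊛ H[x−t] n)) i j
    ≡⟨ ⊛-scalʳ genH c (pow T n ⊛ H[x−t] n) i j ⟩
  c * (genH ⊛ (pow T n ⊛ H[x−t] n)) i j
    ≡⟨ cong (c *_) (trans (⊛-congʳ genH (powT-⊛ n (H[x−t] n)) i j)
                   (trans (⊛-mulTⁿ genH n (H[x−t] n) i j) (mulTⁿ-≥ n (E n) i j n≤j))) ⟩
  c * E n i (j ∸ n)
    ≡⟨ cong (c *_) (E-coeff n i j n≤j) ⟩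
  fromℕ (S n m) * invFact n * (invFact (j ∸ n) * (fromℕ (j !) * genH i j))
    ≡⟨ solve 5 (λ s a b f g → s :* a :* (b :* (f :* g)) := f :* (a :* b) :* s :* g) refl
         (fromℕ (S n m)) (invFact n) (invFact (j ∸ n)) (fromℕ (j !)) (genH i j) ⟩
  fromℕ (j !) * (invFact n * invFact (j ∸ n)) * fromℕ (S n m) * genH i j
    ≡⟨ cong (λ x → x * fromℕ (S n m) * genH i j) (sym (fromℕ-C n≤j)) ⟩
  fromℕ (j C n) * fromℕ (S n m) * genH i j ∎
  where
  open ≡-Reasoning
  c = fromℕ (S n m) * invFact n

rhs-coeff : ∀ m i j → rhs m i j ≡ fromℕ (S (suc j) (suc m)) * genH i j
rhs-coeff m i j = begin
  rhs m i j
    ≡⟨ ⊛-sumT genH F F≡0 i j ⟩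
  sumTo j (λ n → (genH ⊛ F n) i j)
    ≡⟨ sumTo-cong-≤ j (λ n n≤j → rhs-term m n i j n≤j) ⟩
  sumTo j (λ n → fromℕ (j C n) * fromℕ (S n m) * genH i j)
    ≡⟨ sumTo-*ʳ j (genH i j) (λ n → fromℕ (j C n) * fromℕ (S n m)) ⟩
  binomial-S j m * genH i j
    ≡⟨ cong (_* genH i j) (binomial-S≡S j m) ⟩
  fromℕ (S (suc j) (suc m)) * genH i j ∎
  where
  open ≡-Reasoning
  c : ℕ → ℚ
  c n = fromℕ (S n m) * invFact n
  F : ℕ → Ser2
  F n = scal (c n) (pow T n ⊛ H[x−t] n)
  F≡0 : ∀ n i j → j < n → F n i j ≡ 0ℚ
  F≡0 n i j j<n = trans (cong (c n *_) (trans (powT-⊛ n (H[x−t] n) i j) (mulTⁿ-< n (H[x−t] n) i j j<n))) (*-zeroʳ (c n))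

corollary9 : (m : ℕ) → (i j : ℕ) → lhs m i j ≡ rhs m i j
corollary9 m i j = trans (lhs-coeff m i j) (sym (rhs-coeff m i j))
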